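{- For every odd integer $n \ge 5$, $\mathrm{eqdim}(S_n)=2n$.
   Context: All graphs are finite, simple, connected and undirected; $d(u,v)$ denotes the number of edges of a shortest path between $u$ and $v$. A vertex $x$ is equidistant from $u$ and $v$ if $d(u,x)=d(v,x)$. A set $S\subseteq V(G)$ is a distance-equalizer set of $G$ if for every pair of distinct vertices $u,v\in V(G)\setminus S$ there is $x\in S$ equidistant from $u$ and $v$. The equidistant dimension $\mathrm{eqdim}(G)$ is the minimum cardinality of a distance-equalizer set of $G$. The graph $S_n$ has vertex set $\{a_i,b_i,c_i,d_i : i=0,\dots,n-1\}$ and edge set $\{a_ia_{i+1}, b_ib_{i+1}, c_ic_{i+1}, d_id_{i+1}, a_ib_i, b_ic_i, c_id_i, a_{i+1}b_i : i=0,\dots,n-1\}$, with indices taken modulo $n$. -}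

module Defs where

open import Data.Nat using (ℕ; zero; suc; _≤_)
open import Data.Fin using (Fin; toℕ)
open import Data.Product using (Σ; ∃; _×_; _,_)
open import Data.Sum using (_⊎_)
open import Data.List using (List; length)
open import Data.List.Membership.Propositional using (_∈_; _∉_)
open import Data.List.Relation.Unary.Unique.Propositional using (Unique)
open import Relation.Binary.PropositionalEquality using (_≡_; _≢_)

data Walk {V : Set} (E : V → V → Set) : V → V → ℕ → Set where
  here : ∀ {u} → Walk E u u 0
  step : ∀ {u w v k} → E u w → Walk E w v k → Walk E u v (suc k)

Dist : {V : Set} → (V → V → Set) → V → V → ℕ → Set
Dist E u v k = Walk E u v k × (∀ m → Walk E u v m → k ≤ m)

Equidistant : {V : Set} → (V → V → Set) → V → V → V → Set
Equidistant E u v x = ∃ λ k → Dist E u x k × Dist E v x k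

-- Sets of vertices are duplicate-free lists; |S| = length S.
-- S is a distance-equalizer set.
IsDistanceEqualizer : {V : Set} → (V → V → Set) → List V → Set
IsDistanceEqualizer {V} E S =
  ∀ (u v : V) → u ≢ v → u ∉ S → v ∉ S →
    ∃ λ x → x ∈ S × Equidistant E u v x

EqDim : {V : Set} → (V → V → Set) → ℕ → Set
EqDim {V} E k =
  (Σ (List V) λ S → Unique S × IsDistanceEqualizer E S × length S ≡ k)
  × (∀ (S : List V) → Unique S → IsDistanceEqualizer E S → k ≤ length S)

data Layer : Set where
  a b c d : Layer

SVertex : ℕ → Set
SVertex n = Layer × Fin n

Next : {n : ℕ} → Fin n → Fin n → Set
Next {n} i j = (suc (toℕ i) ≡ toℕ j) ⊎ (suc (toℕ i) ≡ n × toℕ j ≡ 0)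

-- the listed edges, each in one orientation
data SArc (n : ℕ) : SVertex n → SVertex n → Set where
  aa : ∀ {i j} → Next i j → SArc n (a , i) (a , j)
  bb : ∀ {i j} → Next i j → SArc n (b , i) (b , j)
  cc : ∀ {i j} → Next i j → SArc n (c , i) (c , j)
  dd : ∀ {i j} → Next i j → SArc n (d , i) (d , j)
  ab : ∀ {i} → SArc n (a , i) (b , i)
  bc : ∀ {i} → SArc n (b , i) (c , i)
  cd : ∀ {i} → SArc n (c , i) (d , i)
  ab' : ∀ {i j} → Next i j → SArc n (a , j) (b , i)

SAdj : (n : ℕ) → SVertex n → SVertex n → Set
SAdj n u v = SArc n u v ⊎ SArc n v u

-- Put a_i and b_i at positions 2i and 2i+1 of a 2n-cycle and give the layers a, b, c, d the heights
-- 0, 0, 1, 2. Then d(u, x) = |height u - height x| + ⌈δ/2⌉, where δ is the cyclic distance between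
-- the positions: this potential vanishes only at x, changes by at most one along every edge, and
-- drops by one along some edge out of every other vertex.
-- The a's and c's form a distance-equalizer set: for odd n any two columns i, j have a column k
-- with δₙ(i,k) = δₙ(j,k), and c_k is then equidistant from the b's and d's of columns i and j.
-- Conversely no vertex is equidistant from c_i and d_i (same position, heights one apart), nor from
-- a_i and b_{i+2}, whose positions are five apart: their halved distances to a vertex could only
-- agree if two numbers with equal halves summed to 1 mod 4, which the parity of n rules out.
-- So an equalizer set meets each of these 2n disjoint pairs.

module Submission where

open import Defs
open import Data.Nat
open import Data.Nat.Properties
open import Data.Nat.DivMod using ([m+n]%n≡m%n; [m+kn]%n≡m%n; m≡m%n+[m/n]*n)
open import Data.Nat.Tactic.RingSolver using (solve)
open import Data.Product using (∃; _×_; _,_; proj₁; proj₂; swap)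
open import Data.Product.Properties using (≡-dec)
open import Data.Sum using (_⊎_; inj₁; inj₂)
import Data.Sum as Sum
open import Data.Empty using (⊥-elim)
open import Data.Fin using (Fin; toℕ; fromℕ<; splitAt; join)
open import Data.Fin.Properties using (toℕ<n; toℕ-fromℕ<; toℕ-injective; join-splitAt; injective⇒≤)
  renaming (_≟_ to _≟ᶠ_)
open import Data.List using (List; []; _∷_; _++_; tabulate; length)
open import Data.List.Properties using (length-++; length-tabulate)
open import Data.List.Membership.Propositional using (_∈_)
open import Data.List.Membership.Propositional.Properties using (∈-++⁺ˡ; ∈-++⁺ʳ; ∈-tabulate⁺; ∈-tabulate⁻)
open import Data.List.Membership.Setoid.Properties using (index-injective)
open import Data.List.Relation.Unary.Any using (index)
open import Data.List.Relation.Unary.Unique.Propositional using (Unique)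
import Data.List.Relation.Unary.Unique.Propositional.Properties as Unique
open import Function using (_∘_)
open import Relation.Binary.Definitions using (DecidableEquality)
open import Relation.Binary.PropositionalEquality
open import Relation.Nullary using (¬_; yes; no; map′)

-- Distances certified by a potential

record DistancePotential {V : Set} (E : V → V → Set) (x : V) (φ : V → ℕ) : Set where
  field
    lipschitz       : ∀ {u w} → E u w → φ u ≤ suc (φ w)
    vanishes        : φ x ≡ 0
    vanishes⇒target : ∀ {u} → φ u ≡ 0 → u ≡ x
    descent         : ∀ {u k} → φ u ≡ suc k → ∃ λ w → E u w × φ w ≡ k

module _ {V : Set} {E : V → V → Set} where

  Dist-unique : ∀ {u v k k′} → Dist E u v k → Dist E u v k′ → k ≡ k′
  Dist-unique (walk , shortest) (walk′ , shortest′) = ≤-antisym (shortest _ walk′) (shortest′ _ walk)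

  module _ {x : V} {φ : V → ℕ} (P : DistancePotential E x φ) where
    open DistancePotential P

    potential≤length : ∀ {u m} → Walk E u x m → φ u ≤ m
    potential≤length here           = ≤-reflexive vanishes
    potential≤length (step uw walk) = ≤-trans (lipschitz uw) (s≤s (potential≤length walk))

    descending-walk : ∀ k {u} → φ u ≡ k → Walk E u x k
    descending-walk zero    φu≡0 = subst (λ v → Walk E v x 0) (sym (vanishes⇒target φu≡0)) here
    descending-walk (suc k) φu≡1+k with descent φu≡1+k
    ... | w , uw , φw≡k = step uw (descending-walk k φw≡k)

    potential-Dist : ∀ u → Dist E u x (φ u)
    potential-Dist u = descending-walk (φ u) refl , λ _ → potential≤length

    Dist⇒≡potential : ∀ {u k} → Dist E u x k → k ≡ φ u
    Dist⇒≡potential D = Dist-unique D (potential-Dist _)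

    equal-potential⇒Equidistant : ∀ {u v} → φ u ≡ φ v → Equidistant E u v x
    equal-potential⇒Equidistant {u} {v} φu≡φv =
      φ u , potential-Dist u , subst (Dist E v x) (sym φu≡φv) (potential-Dist v)

    Equidistant⇒equal-potential : ∀ {u v} → Equidistant E u v x → φ u ≡ φ v
    Equidistant⇒equal-potential (_ , Du , Dv) = trans (sym (Dist⇒≡potential Du)) (Dist⇒≡potential Dv)

module _ {V : Set} {E : V → V → Set} (_≟_ : DecidableEquality V)
         {S : List V} (S-equalizer : IsDistanceEqualizer E S) where
  open import Data.List.Membership.DecPropositional _≟_ using (_∈?_)

  equalizer-meets : ∀ {u v} → u ≢ v → (∀ x → ¬ Equidistant E u v x) → u ∈ S ⊎ v ∈ S
  equalizer-meets {u} {v} u≢v no-equidistant with u ∈? S | v ∈? S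
  ... | yes u∈S | _       = inj₁ u∈S
  ... | no _    | yes v∈S = inj₂ v∈S
  ... | no u∉S  | no v∉S  with S-equalizer u v u≢v u∉S v∉S
  ...   | x , _ , equidistant = ⊥-elim (no-equidistant x equidistant)

injection⇒≤length : ∀ {A : Set} {k} {xs : List A} (f : Fin k → A) →
                    (∀ {s t} → f s ≡ f t → s ≡ t) → (∀ s → f s ∈ xs) → k ≤ length xs
injection⇒≤length {A} f f-injective f∈xs =
  injective⇒≤ {f = index ∘ f∈xs} (f-injective ∘ index-injective (setoid A) (f∈xs _) (f∈xs _))

-- Arithmetic on the N-cycle

Shift : ℕ → ℕ → ℕ → ℕ → Set
Shift N p r q = p < N × r < N × q < N × (p + r ≡ q ⊎ p + r ≡ q + N)

opaque
  offset : ℕ → ℕ → ℕ → ℕ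
  offset N p q with p ≤? q
  ... | yes _ = q ∸ p
  ... | no  _ = q + N ∸ p

  shift-offset : ∀ {N p q} → p < N → q < N → Shift N p (offset N p q) q
  shift-offset {N} {p} {q} p<N q<N with p ≤? q
  ... | yes p≤q = p<N , ≤-<-trans (m∸n≤m q p) q<N , q<N , inj₁ (m+[n∸m]≡n p≤q)
  ... | no  p≰q = p<N , q+N∸p<N , q<N , inj₂ (m+[n∸m]≡n (≤-trans (<⇒≤ p<N) (m≤n+m N q)))
    where
    q+N∸p<N : q + N ∸ p < N
    q+N∸p<N = m<n+o⇒m∸n<o (q + N) p {{>-nonZero (≤-<-trans z≤n p<N)}} (+-monoˡ-< N (≰⇒> p≰q))

private
  Wrap : ℕ → ℕ → Set
  Wrap N w = w ≡ 0 ⊎ w ≡ N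

  wrap : ∀ {N p r q} → Shift N p r q → ∃ λ w → Wrap N w × p + r ≡ q + w
  wrap {q = q} (_ , _ , _ , inj₁ e) = 0 , inj₁ refl , trans e (sym (+-identityʳ q))
  wrap         (_ , _ , _ , inj₂ e) = _ , inj₂ refl , e

  -- the defining equations p + s = m + A, m + t = q + B, p + r = q + C with p, m, q eliminated
  balance : ∀ p m q {s t r A B C} → p + s ≡ m + A → m + t ≡ q + B → p + r ≡ q + C →
            s + t + C ≡ r + (A + B)
  balance p m q {s} {t} {r} {A} {B} {C} e₁ e₂ e₃ = +-cancelˡ-≡ p _ _ (begin
    p + (s + t + C)    ≡⟨ solve (p ∷ s ∷ t ∷ C ∷ []) ⟩
    (p + s) + t + C    ≡⟨ cong (λ x → x + t + C) e₁ ⟩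
    (m + A) + t + C    ≡⟨ solve (m ∷ A ∷ t ∷ C ∷ []) ⟩
    (m + t) + A + C    ≡⟨ cong (λ x → x + A + C) e₂ ⟩
    (q + B) + A + C    ≡⟨ solve (q ∷ B ∷ A ∷ C ∷ []) ⟩
    (q + C) + (A + B)  ≡⟨ cong (_+ (A + B)) e₃ ⟨
    (p + r) + (A + B)  ≡⟨ +-assoc p r (A + B) ⟩
    p + (r + (A + B))  ∎)
    where open ≡-Reasoning

  cross-cancel : ∀ p q {r w r′ w′} → p + r ≡ q + w → p + r′ ≡ q + w′ → r + w′ ≡ r′ + w
  cross-cancel p q {r} {w} {r′} {w′} e e′ = +-cancelˡ-≡ p _ _ (begin
    p + (r + w′)   ≡⟨ +-assoc p r w′ ⟨
    p + r + w′     ≡⟨ cong (_+ w′) e ⟩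
    q + w + w′     ≡⟨ solve (q ∷ w ∷ w′ ∷ []) ⟩
    q + w′ + w     ≡⟨ cong (_+ w) e′ ⟨
    p + r′ + w     ≡⟨ +-assoc p r′ w ⟩
    p + (r′ + w)   ∎)
    where open ≡-Reasoning

  no-wrap : ∀ {N r r′} → r′ < N → r + N ≢ r′ + 0
  no-wrap {N} {r} {r′} r′<N e =
    m+n≮n r N (subst (_< N) (trans (sym (+-identityʳ r′)) (sym e)) r′<N)

shift-unique : ∀ {N p q r r′} → Shift N p r q → Shift N p r′ q → r ≡ r′
shift-unique {p = p} {q} sh@(_ , r<N , _) sh′@(_ , r′<N , _) with wrap sh | wrap sh′
... | _ , inj₁ refl , e | _ , inj₁ refl , e′ = +-cancelʳ-≡ 0 _ _ (cross-cancel p q e e′)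
... | _ , inj₂ refl , e | _ , inj₂ refl , e′ = +-cancelʳ-≡ _ _ _ (cross-cancel p q e e′)
... | _ , inj₁ refl , e | _ , inj₂ refl , e′ = ⊥-elim (no-wrap r′<N (cross-cancel p q e e′))
... | _ , inj₂ refl , e | _ , inj₁ refl , e′ = ⊥-elim (no-wrap r<N (sym (cross-cancel p q e e′)))

shift-trans : ∀ {N p s m t q r} → Shift N p s m → Shift N m t q → Shift N p r q →
              s + t ≡ r ⊎ s + t ≡ r + N
shift-trans {N} {p} {s} {m} {t} {q} {r} sh₁@(_ , s<N , _) sh₂@(_ , t<N , _) sh@(_ , r<N , _)
  with wrap sh₁ | wrap sh₂ | wrap sh
... | _ , inj₁ refl , e₁ | _ , inj₁ refl , e₂ | _ , inj₁ refl , e =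
  inj₁ (+-cancelʳ-≡ 0 _ _ (balance p m q e₁ e₂ e))
... | _ , inj₁ refl , e₁ | _ , inj₁ refl , e₂ | _ , inj₂ refl , e =
  ⊥-elim (no-wrap r<N (balance p m q e₁ e₂ e))
... | _ , inj₁ refl , e₁ | _ , inj₂ refl , e₂ | _ , inj₁ refl , e =
  inj₂ (trans (sym (+-identityʳ _)) (balance p m q e₁ e₂ e))
... | _ , inj₂ refl , e₁ | _ , inj₁ refl , e₂ | _ , inj₁ refl , e =
  inj₂ (trans (sym (+-identityʳ _)) (trans (balance p m q e₁ e₂ e) (cong (r +_) (+-identityʳ N))))
... | _ , inj₁ refl , e₁ | _ , inj₂ refl , e₂ | _ , inj₂ refl , e =
  inj₁ (+-cancelʳ-≡ N _ _ (balance p m q e₁ e₂ e))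
... | _ , inj₂ refl , e₁ | _ , inj₁ refl , e₂ | _ , inj₂ refl , e =
  inj₁ (+-cancelʳ-≡ N _ _ (trans (balance p m q e₁ e₂ e) (cong (r +_) (+-identityʳ N))))
... | _ , inj₂ refl , e₁ | _ , inj₂ refl , e₂ | _ , inj₁ refl , e =
  ⊥-elim (<-irrefl refl (begin-strict
    s + t + 0   ≡⟨ +-identityʳ (s + t) ⟩
    s + t       <⟨ +-mono-< s<N t<N ⟩
    N + N       ≤⟨ m≤n+m (N + N) r ⟩
    r + (N + N) ≡⟨ balance p m q e₁ e₂ e ⟨
    s + t + 0   ∎))
  where open ≤-Reasoning
... | _ , inj₂ refl , e₁ | _ , inj₂ refl , e₂ | _ , inj₂ refl , e =
  inj₂ (+-cancelʳ-≡ N _ _ (trans (balance p m q e₁ e₂ e) (sym (+-assoc r N N))))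

offset-unique : ∀ {N p q r} → Shift N p r q → offset N p q ≡ r
offset-unique sh@(p<N , _ , q<N , _) = shift-unique (shift-offset p<N q<N) sh

shift-zero : ∀ {N p} → p < N → Shift N p 0 p
shift-zero p<N = p<N , ≤-<-trans z≤n p<N , p<N , inj₁ (+-identityʳ _)

shift-target : ∀ {N p r} → p < N → r < N → ∃ λ q → Shift N p r q
shift-target {N} {p} {r} p<N r<N with p + r <? N
... | yes p+r<N = p + r , p<N , r<N , p+r<N , inj₁ refl
... | no  p+r≮N = p + r ∸ N , p<N , r<N , p+r∸N<N , inj₂ (sym (m∸n+n≡m (≮⇒≥ p+r≮N)))
  where
  p+r∸N<N : p + r ∸ N < N
  p+r∸N<N = m<n+o⇒m∸n<o (p + r) N {{>-nonZero (≤-<-trans z≤n p<N)}} (+-mono-< p<N r<N)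

shift-compose : ∀ {N p s m t q} → Shift N p s m → Shift N m t q → s + t < N → Shift N p (s + t) q
shift-compose {N} {p} {q = q} sh₁@(p<N , _) sh₂@(_ , _ , q<N , _) s+t<N
  with shift-trans sh₁ sh₂ (shift-offset p<N q<N)
... | inj₁ e = subst (λ r → Shift N p r q) (sym e) (shift-offset p<N q<N)
... | inj₂ e = ⊥-elim (m+n≮n (offset N p q) N (subst (_< N) e s+t<N))

-- Next i j (from Defs) unfolds to SucMod n (toℕ i) (toℕ j)
SucMod : ℕ → ℕ → ℕ → Set
SucMod N r r′ = suc r ≡ r′ ⊎ (suc r ≡ N × r′ ≡ 0)

shift-suc : ∀ {N p p′ q r r′} → Shift N p 1 p′ → Shift N p′ r′ q → Shift N p r q → SucMod N r′ r
shift-suc {N} {r = r} {r′} sh₁ sh₂@(_ , r′<N , _) sh with shift-trans sh₁ sh₂ sh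
... | inj₁ e = inj₁ e
... | inj₂ e with r
...   | zero  = inj₂ (e , refl)
...   | suc _ = ⊥-elim (m+n≮n _ N (subst (_≤ N) e r′<N))

sucmod-target : ∀ {N r} → r < N → ∃ λ r′ → r′ < N × SucMod N r r′
sucmod-target {N} {r} r<N with suc r <? N
... | yes 1+r<N = suc r , 1+r<N , inj₁ refl
... | no  1+r≮N = 0 , ≤-<-trans z≤n r<N , inj₂ (≤-antisym r<N (≮⇒≥ 1+r≮N) , refl)

sucmod-source : ∀ {N r′} → r′ < N → ∃ λ r → r < N × SucMod N r r′
sucmod-source {suc N} {zero}   _           = N , ≤-refl , inj₂ (refl , refl)
sucmod-source {N}     {suc r′} 1+r′<N      = r′ , <-trans (n<1+n r′) 1+r′<N , inj₁ refl

sucmod-injective : ∀ {N r s r′} → SucMod N r r′ → SucMod N s r′ → r ≡ s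
sucmod-injective (inj₁ e)       (inj₁ e′)       = suc-injective (trans e (sym e′))
sucmod-injective (inj₂ (e , _)) (inj₂ (e′ , _)) = suc-injective (trans e (sym e′))
sucmod-injective (inj₁ refl)    (inj₂ (_ , ()))
sucmod-injective (inj₂ (_ , ())) (inj₁ refl)

sucmod⇒shift : ∀ {N r r′} → 1 < N → r < N → r′ < N → SucMod N r r′ → Shift N r 1 r′
sucmod⇒shift {N} {r} 1<N r<N r′<N sm = r<N , 1<N , r′<N , unit-step sm
  where
  unit-step : ∀ {r′} → SucMod N r r′ → r + 1 ≡ r′ ⊎ r + 1 ≡ r′ + N
  unit-step (inj₁ refl)       = inj₁ (+-comm r 1)
  unit-step (inj₂ (e , refl)) = inj₂ (trans (+-comm r 1) e)

cyc : ℕ → ℕ → ℕ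
cyc N r = r ⊓ (N ∸ r)

cyc≡0⇒≡0 : ∀ {N r} → r < N → cyc N r ≡ 0 → r ≡ 0
cyc≡0⇒≡0 {N} {r} r<N e with ⊓-sel r (N ∸ r)
... | inj₁ c≡r = trans (sym c≡r) e
... | inj₂ c≡N∸r = ⊥-elim (<⇒≢ (m<n⇒0<n∸m r<N) (sym (trans (sym c≡N∸r) e)))

cyc-complement : ∀ {N r r′} → r + r′ ≡ N → cyc N r ≡ cyc N r′
cyc-complement {r = r} {r′} refl = begin
  r ⊓ (r + r′ ∸ r)    ≡⟨ cong (r ⊓_) (m+n∸m≡n r r′) ⟩
  r ⊓ r′              ≡⟨ ⊓-comm r r′ ⟩
  r′ ⊓ r              ≡⟨ cong (r′ ⊓_) (m+n∸n≡m r r′) ⟨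
  r′ ⊓ (r + r′ ∸ r′)  ∎
  where open ≡-Reasoning

private
  ∸-unfold : ∀ {N r} → r < N → N ∸ r ≡ suc (N ∸ suc r)
  ∸-unfold r<N = +-∸-assoc 1 r<N

cyc-step : ∀ {N r r′} → SucMod N r r′ → r′ < N →
           cyc N r ≤ suc (cyc N r′) × cyc N r′ ≤ suc (cyc N r)
cyc-step {N} {r} (inj₁ refl) r′<N rewrite ∸-unfold (<⇒≤ r′<N) =
    ⊓-monoˡ-≤ (suc (N ∸ suc r)) (m≤n⇒m≤1+n (n≤1+n r))
  , ⊓-monoʳ-≤ (suc r) (m≤n⇒m≤1+n (n≤1+n (N ∸ suc r)))
cyc-step {N} {r} (inj₂ (1+r≡N , refl)) _ =
  ≤-trans (m⊓n≤n r (N ∸ r)) (≤-reflexive (trans (cong (_∸ r) (sym 1+r≡N)) (m+n∸n≡m 1 r))) , z≤n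

cyc-descent : ∀ {N r r⁺ r⁻ k} → SucMod N r⁺ r → SucMod N r r⁻ → r < N → cyc N r ≡ suc k →
              cyc N r⁺ ≡ k ⊎ cyc N r⁻ ≡ k
cyc-descent {N} {r} {r⁺} {r⁻} {k} sm⁺ sm⁻ r<N e with r ≤? N ∸ r
... | yes r≤N∸r = inj₁ (forward sm⁺)
  where
  r≡1+k : r ≡ suc k
  r≡1+k = trans (sym (m≤n⇒m⊓n≡m r≤N∸r)) e
  forward : SucMod N r⁺ r → cyc N r⁺ ≡ k
  forward (inj₁ refl) =
    trans (m≤n⇒m⊓n≡m (≤-trans (n≤1+n r⁺) (≤-trans r≤N∸r (∸-monoʳ-≤ N (n≤1+n r⁺)))))
          (suc-injective r≡1+k)
  forward (inj₂ (_ , r≡0)) = ⊥-elim (0≢1+n (trans (sym r≡0) r≡1+k))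
... | no r≰N∸r = inj₂ (backward sm⁻)
  where
  N∸r≡1+k : N ∸ r ≡ suc k
  N∸r≡1+k = trans (sym (m≥n⇒m⊓n≡n (<⇒≤ (≰⇒> r≰N∸r)))) e
  backward : SucMod N r r⁻ → cyc N r⁻ ≡ k
  backward (inj₁ refl) = trans (cong (suc r ⊓_) N∸1+r≡k) (m≥n⇒m⊓n≡n k≤1+r)
    where
    N∸1+r≡k : N ∸ suc r ≡ k
    N∸1+r≡k = suc-injective (trans (sym (∸-unfold r<N)) N∸r≡1+k)
    k≤1+r : k ≤ suc r
    k≤1+r = ≤-trans (n≤1+n k)
                    (≤-trans (≤-reflexive (sym N∸r≡1+k)) (≤-trans (<⇒≤ (≰⇒> r≰N∸r)) (n≤1+n r)))
  backward (inj₂ (1+r≡N , refl)) =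
    sym (suc-injective (trans (sym N∸r≡1+k) (trans (cong (_∸ r) (sym 1+r≡N)) (m+n∸n≡m 1 r))))

dist : ℕ → ℕ → ℕ → ℕ
dist N p q = cyc N (offset N p q)

dist-shift : ∀ {N p q r} → Shift N p r q → dist N p q ≡ cyc N r
dist-shift sh = cong (cyc _) (offset-unique sh)

dist-self : ∀ {N p} → p < N → dist N p p ≡ 0
dist-self p<N = dist-shift (shift-zero p<N)

dist≡0⇒≡ : ∀ {N p q} → p < N → q < N → dist N p q ≡ 0 → p ≡ q
dist≡0⇒≡ {N} {p} {q} p<N q<N e with zero-shift
  where
  zero-shift : Shift N p 0 q
  zero-shift = subst (λ r → Shift N p r q) (cyc≡0⇒≡0 (proj₁ (proj₂ (shift-offset p<N q<N))) e)
                     (shift-offset p<N q<N)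
... | _ , _ , _ , inj₁ p+0≡q   = trans (sym (+-identityʳ p)) p+0≡q
... | _ , _ , _ , inj₂ p+0≡q+N =
  ⊥-elim (m+n≮n q N (subst (_< N) (trans (sym (+-identityʳ p)) p+0≡q+N) p<N))

dist-sym : ∀ {N p q} → p < N → q < N → dist N p q ≡ dist N q p
dist-sym {N} {p} {q} p<N q<N
  with shift-trans (shift-offset p<N q<N) (shift-offset q<N p<N) (shift-zero p<N)
... | inj₁ r+r′≡0 = cong (cyc N) (trans (m+n≡0⇒m≡0 _ r+r′≡0) (sym (m+n≡0⇒n≡0 _ r+r′≡0)))
... | inj₂ r+r′≡N = cyc-complement r+r′≡N

dist-step : ∀ {N p p′ q} → Shift N p 1 p′ → q < N →
            dist N p q ≤ suc (dist N p′ q) × dist N p′ q ≤ suc (dist N p q)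
dist-step sh@(p<N , _ , p′<N , _) q<N =
  swap (cyc-step (shift-suc sh (shift-offset p′<N q<N) (shift-offset p<N q<N))
                 (proj₁ (proj₂ (shift-offset p<N q<N))))

dist-descent : ∀ {N p⁻ p p⁺ q k} → Shift N p⁻ 1 p → Shift N p 1 p⁺ → q < N → dist N p q ≡ suc k →
               dist N p⁺ q ≡ k ⊎ dist N p⁻ q ≡ k
dist-descent sh⁻@(p⁻<N , _) sh⁺@(p<N , _ , p⁺<N , _) q<N =
  cyc-descent (shift-suc sh⁺ (shift-offset p⁺<N q<N) (shift-offset p<N q<N))
              (shift-suc sh⁻ (shift-offset p<N q<N) (shift-offset p⁻<N q<N))
              (proj₁ (proj₂ (shift-offset p<N q<N)))

dist-step₂ : ∀ {N p m p′ q} → Shift N p 1 m → Shift N m 1 p′ → q < N →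
             dist N p q ≤ 2 + dist N p′ q × dist N p′ q ≤ 2 + dist N p q
dist-step₂ sh sh′ q<N with dist-step sh q<N | dist-step sh′ q<N
... | p≤m , m≤p | m≤p′ , p′≤m = ≤-trans p≤m (s≤s m≤p′) , ≤-trans p′≤m (s≤s m≤p)

dist-descent₂ : ∀ {N p⁻⁻ m⁻ p m⁺ p⁺⁺ q k} →
                Shift N p⁻⁻ 1 m⁻ → Shift N m⁻ 1 p → Shift N p 1 m⁺ → Shift N m⁺ 1 p⁺⁺ → q < N →
                dist N p q ≡ 2 + k → dist N p⁺⁺ q ≡ k ⊎ dist N p⁻⁻ q ≡ k
dist-descent₂ {k = k} sh₁ sh₂ sh₃ sh₄ q<N e with dist-descent sh₂ sh₃ q<N e
... | inj₁ e⁺ with dist-descent sh₃ sh₄ q<N e⁺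
...   | inj₁ e⁺⁺ = inj₁ e⁺⁺
...   | inj₂ e′  = ⊥-elim (m≢1+n+m k (trans (sym e′) e))
dist-descent₂ {k = k} sh₁ sh₂ sh₃ sh₄ q<N e | inj₂ e⁻ with dist-descent sh₁ sh₂ q<N e⁻
...   | inj₁ e′  = ⊥-elim (m≢1+n+m k (trans (sym e′) e))
...   | inj₂ e⁻⁻ = inj₂ e⁻⁻

1+2*<2* : ∀ {i n} → i < n → suc (2 * i) < 2 * n
1+2*<2* {i} {n} i<n = subst (_≤ 2 * n) (*-suc 2 i) (*-monoʳ-≤ 2 i<n)

private
  2*-+ : ∀ x y {z} → x + y ≡ z → 2 * x + 2 * y ≡ 2 * z
  2*-+ x y e = trans (sym (*-distribˡ-+ 2 x y)) (cong (2 *_) e)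

shift-double : ∀ {n i s k} → Shift n i s k → Shift (2 * n) (suc (2 * i)) (2 * s) (suc (2 * k))
shift-double {n} {i} {s} {k} (i<n , s<n , k<n , e) =
  1+2*<2* i<n , *-monoʳ-< 2 s<n , 1+2*<2* k<n , double e
  where
  double : i + s ≡ k ⊎ i + s ≡ k + n →
           suc (2 * i) + 2 * s ≡ suc (2 * k) ⊎ suc (2 * i) + 2 * s ≡ suc (2 * k) + 2 * n
  double (inj₁ e) = inj₁ (cong suc (2*-+ i s e))
  double (inj₂ e) = inj₂ (cong suc (trans (2*-+ i s e) (*-distribˡ-+ 2 k n)))

shift-even-odd : ∀ {n i} → i < n → Shift (2 * n) (2 * i) 1 (suc (2 * i))
shift-even-odd {n} {i} i<n =
  *-monoʳ-< 2 i<n , ≤-trans (s≤s (s≤s z≤n)) (1+2*<2* i<n) , 1+2*<2* i<n , inj₁ (+-comm (2 * i) 1)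

shift-odd-even : ∀ {n i j} → Shift n i 1 j → Shift (2 * n) (suc (2 * i)) 1 (2 * j)
shift-odd-even {n} {i} {j} (i<n , 1<n , j<n , e) =
  1+2*<2* i<n , ≤-trans 1<n (m≤n*m n 2) , *-monoʳ-< 2 j<n , double-step e
  where
  1+2*i+1≡2*[i+1] : suc (2 * i) + 1 ≡ 2 * i + 2 * 1
  1+2*i+1≡2*[i+1] = solve (i ∷ [])
  double-step : i + 1 ≡ j ⊎ i + 1 ≡ j + n →
                suc (2 * i) + 1 ≡ 2 * j ⊎ suc (2 * i) + 1 ≡ 2 * j + 2 * n
  double-step (inj₁ e) = inj₁ (trans 1+2*i+1≡2*[i+1] (2*-+ i 1 e))
  double-step (inj₂ e) = inj₂ (trans 1+2*i+1≡2*[i+1] (trans (2*-+ i 1 e) (*-distribˡ-+ 2 j n)))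

cyc-double : ∀ n r → cyc (2 * n) (2 * r) ≡ 2 * cyc n r
cyc-double n r = begin
  (2 * r) ⊓ (2 * n ∸ 2 * r)    ≡⟨ cong ((2 * r) ⊓_) (*-distribˡ-∸ 2 n r) ⟨
  (2 * r) ⊓ (2 * (n ∸ r))      ≡⟨ *-distribˡ-⊓ 2 r (n ∸ r) ⟨
  2 * (r ⊓ (n ∸ r))          ∎
  where open ≡-Reasoning

dist-double : ∀ {n i j} → i < n → j < n → dist (2 * n) (suc (2 * i)) (suc (2 * j)) ≡ 2 * dist n i j
dist-double {n} {i} {j} i<n j<n =
  trans (dist-shift (shift-double (shift-offset i<n j<n))) (cyc-double n (offset n i j))

⌈2*n/2⌉≡n : ∀ n → ⌈ 2 * n /2⌉ ≡ n
⌈2*n/2⌉≡n n = trans (cong ⌈_/2⌉ (cong (n +_) (+-identityʳ n))) (sym (n≡⌈n+n/2⌉ n))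

⌈m⊓n/2⌉≡⌈m/2⌉⊓⌈n/2⌉ : ∀ x y → ⌈ x ⊓ y /2⌉ ≡ ⌈ x /2⌉ ⊓ ⌈ y /2⌉
⌈m⊓n/2⌉≡⌈m/2⌉⊓⌈n/2⌉ = mono-≤-distrib-⊓ ⌈n/2⌉-mono

⌈y/2⌉≡⌈z/2⌉⇒[y+z]%4≢1 : ∀ y z → ⌈ y /2⌉ ≡ ⌈ z /2⌉ → (y + z) % 4 ≢ 1
⌈y/2⌉≡⌈z/2⌉⇒[y+z]%4≢1 0 0 _ ()
⌈y/2⌉≡⌈z/2⌉⇒[y+z]%4≢1 1 1 _ ()
⌈y/2⌉≡⌈z/2⌉⇒[y+z]%4≢1 1 2 _ ()
⌈y/2⌉≡⌈z/2⌉⇒[y+z]%4≢1 2 1 _ ()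
⌈y/2⌉≡⌈z/2⌉⇒[y+z]%4≢1 (suc (suc y)) (suc (suc z)) e h =
  ⌈y/2⌉≡⌈z/2⌉⇒[y+z]%4≢1 y z (suc-injective e) (trans (sym drop-4) h)
  where
  drop-4 : (suc (suc y) + suc (suc z)) % 4 ≡ (y + z) % 4
  drop-4 = trans (cong (_% 4) sum≡) ([m+n]%n≡m%n (y + z) 4)
    where
    sum≡ : suc (suc y) + suc (suc z) ≡ y + z + 4
    sum≡ = solve (y ∷ z ∷ [])

⊓-cross : ∀ {m n x y} → x < m → y < n → m ⊓ y ≡ x ⊓ n → y ≡ x
⊓-cross {m} {n} {x} {y} x<m y<n e with ⊓-sel m y | ⊓-sel x n
... | inj₁ m⊓y≡m | _ = ⊥-elim (<⇒≱ x<m (≤-trans (≤-reflexive (trans (sym m⊓y≡m) e)) (m⊓n≤m x n)))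
... | inj₂ m⊓y≡y | inj₁ x⊓n≡x = trans (sym m⊓y≡y) (trans e x⊓n≡x)
... | inj₂ m⊓y≡y | inj₂ x⊓n≡n = ⊥-elim (<⇒≢ y<n (trans (sym m⊓y≡y) (trans e x⊓n≡n)))

-- Both cyc values are minima of two arcs, and ⌈_/2⌉ commutes with _⊓_. In each configuration
-- ⊓-cross leaves two arcs with equal halves whose lengths sum to 1 mod 4 (using ⌈ 2 + x /2⌉ =
-- suc ⌈ x /2⌉ definitionally for the strict inequalities).
cyc-5-apart : ∀ {N k r r′} → N ≡ 2 + 4 * k → 10 ≤ N → r < N → r′ < N →
              (5 + r′ ≡ r ⊎ 5 + r′ ≡ r + N) → ⌈ cyc N r /2⌉ ≢ ⌈ cyc N r′ /2⌉
cyc-5-apart {N} {k} {r} {r′} N≡2+4k _ r<N r′<N (inj₁ refl) e with m≤n⇒∃[o]m+o≡n (<⇒≤ r<N)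
... | y , refl =
  ⌈y/2⌉≡⌈z/2⌉⇒[y+z]%4≢1 y r′
    (⊓-cross (⌈n/2⌉-mono (+-monoˡ-≤ r′ 2≤5)) (⌈n/2⌉-mono (+-monoˡ-≤ y 2≤5)) halves) y+r′%4≡1
  where
  2≤5 : 2 ≤ 5
  2≤5 = s≤s (s≤s z≤n)
  halves : ⌈ 5 + r′ /2⌉ ⊓ ⌈ y /2⌉ ≡ ⌈ r′ /2⌉ ⊓ ⌈ 5 + y /2⌉
  halves = begin
    ⌈ 5 + r′ /2⌉ ⊓ ⌈ y /2⌉               ≡⟨ ⌈m⊓n/2⌉≡⌈m/2⌉⊓⌈n/2⌉ (5 + r′) y ⟨
    ⌈ (5 + r′) ⊓ y /2⌉                   ≡⟨ cong (λ z → ⌈ (5 + r′) ⊓ z /2⌉) (m+n∸m≡n (5 + r′) y) ⟨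
    ⌈ cyc (5 + r′ + y) (5 + r′) /2⌉      ≡⟨ e ⟩
    ⌈ cyc (5 + r′ + y) r′ /2⌉            ≡⟨ cong (λ z → ⌈ r′ ⊓ (z ∸ r′) /2⌉) (solve (r′ ∷ y ∷ [])) ⟩
    ⌈ r′ ⊓ (r′ + (5 + y) ∸ r′) /2⌉       ≡⟨ cong (λ z → ⌈ r′ ⊓ z /2⌉) (m+n∸m≡n r′ (5 + y)) ⟩
    ⌈ r′ ⊓ (5 + y) /2⌉                   ≡⟨ ⌈m⊓n/2⌉≡⌈m/2⌉⊓⌈n/2⌉ r′ (5 + y) ⟩
    ⌈ r′ /2⌉ ⊓ ⌈ 5 + y /2⌉               ∎
    where open ≡-Reasoning
  y+r′%4≡1 : (y + r′) % 4 ≡ 1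
  y+r′%4≡1 = begin
    (y + r′) % 4      ≡⟨ [m+n]%n≡m%n (y + r′) 4 ⟨
    (y + r′ + 4) % 4  ≡⟨ cong (_% 4) (suc-injective (trans shuffle (trans N≡2+4k regroup))) ⟩
    (1 + k * 4) % 4   ≡⟨ [m+kn]%n≡m%n 1 k 4 ⟩
    1                 ∎
    where
    open ≡-Reasoning
    shuffle : suc (y + r′ + 4) ≡ 5 + r′ + y
    shuffle = solve (y ∷ r′ ∷ [])
    regroup : 2 + 4 * k ≡ suc (1 + k * 4)
    regroup = solve (k ∷ [])
cyc-5-apart {N} {k} {r} {r′} _ 10≤N r<N r′<N (inj₂ e₅) e with m≤n⇒∃[o]m+o≡n (<⇒≤ r′<N)
... | w , refl =
  ⌈y/2⌉≡⌈z/2⌉⇒[y+z]%4≢1 r w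
    (⊓-cross (⌈n/2⌉-mono 2+w≤N∸r) (⌈n/2⌉-mono 2+r≤r′) halves) (cong (_% 4) r+w≡5)
  where
  r+w≡5 : r + w ≡ 5
  r+w≡5 = sym (+-cancelˡ-≡ r′ 5 (r + w) (trans (+-comm r′ 5) (trans e₅ reassoc)))
    where
    reassoc : r + (r′ + w) ≡ r′ + (r + w)
    reassoc = solve (r ∷ r′ ∷ w ∷ [])
  5+r≤r′ : 5 + r ≤ r′
  5+r≤r′ = +-cancelʳ-≤ w (5 + r) r′
             (subst (_≤ r′ + w) (trans (cong (5 +_) (sym r+w≡5)) (sym (+-assoc 5 r w))) 10≤N)
  2+r≤r′ : 2 + r ≤ r′
  2+r≤r′ = ≤-trans (+-monoˡ-≤ r (s≤s (s≤s z≤n))) 5+r≤r′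
  2+w≤N∸r : 2 + w ≤ r′ + w ∸ r
  2+w≤N∸r = m+n≤o⇒m≤o∸n (2 + w) (subst (_≤ r′ + w) swap-r-w (+-monoˡ-≤ w 2+r≤r′))
    where
    swap-r-w : 2 + r + w ≡ 2 + w + r
    swap-r-w = solve (r ∷ w ∷ [])
  halves : ⌈ r′ + w ∸ r /2⌉ ⊓ ⌈ r /2⌉ ≡ ⌈ w /2⌉ ⊓ ⌈ r′ /2⌉
  halves = begin
    ⌈ r′ + w ∸ r /2⌉ ⊓ ⌈ r /2⌉        ≡⟨ ⊓-comm _ _ ⟩
    ⌈ r /2⌉ ⊓ ⌈ r′ + w ∸ r /2⌉        ≡⟨ ⌈m⊓n/2⌉≡⌈m/2⌉⊓⌈n/2⌉ r (r′ + w ∸ r) ⟨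
    ⌈ cyc (r′ + w) r /2⌉              ≡⟨ e ⟩
    ⌈ r′ ⊓ (r′ + w ∸ r′) /2⌉          ≡⟨ cong (λ z → ⌈ r′ ⊓ z /2⌉) (m+n∸m≡n r′ w) ⟩
    ⌈ r′ ⊓ w /2⌉                      ≡⟨ ⌈m⊓n/2⌉≡⌈m/2⌉⊓⌈n/2⌉ r′ w ⟩
    ⌈ r′ /2⌉ ⊓ ⌈ w /2⌉                ≡⟨ ⊓-comm _ _ ⟩
    ⌈ w /2⌉ ⊓ ⌈ r′ /2⌉                ∎
    where open ≡-Reasoning

dist-5-apart : ∀ {N k p p′ q} → N ≡ 2 + 4 * k → 10 ≤ N → Shift N p 5 p′ → q < N →
               ⌈ dist N p q /2⌉ ≢ ⌈ dist N p′ q /2⌉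
dist-5-apart {k = k} N≡2+4k 10≤N sh@(p<N , _ , p′<N , _) q<N =
  cyc-5-apart {k = k} N≡2+4k 10≤N
    (proj₁ (proj₂ (shift-offset p<N q<N))) (proj₁ (proj₂ (shift-offset p′<N q<N)))
    (shift-trans sh (shift-offset p′<N q<N) (shift-offset p<N q<N))

private
  even⊎odd : ∀ t → ∃ λ u → t ≡ 2 * u ⊎ t ≡ suc (2 * u)
  even⊎odd zero = 0 , inj₁ refl
  even⊎odd (suc t) with even⊎odd t
  ... | u , inj₁ e = u , inj₂ (cong suc e)
  ... | u , inj₂ e = suc u , inj₁ (trans (cong suc e) (sym (*-suc 2 u)))

halve : ∀ {n m t} → n ≡ suc (2 * m) → t < n → ∃ λ s → Shift n s s t
halve {n} {m} {t} n≡1+2m t<n with even⊎odd t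
... | u , inj₁ refl = u , u<n , u<n , t<n , inj₁ u+u≡2u
  where
  u<n : u < n
  u<n = ≤-<-trans (m≤n*m u 2) t<n
  u+u≡2u : u + u ≡ 2 * u
  u+u≡2u = solve (u ∷ [])
... | u , inj₂ refl =
  suc (u + m) , s<n , s<n , t<n , inj₂ (trans s+s≡t+n (cong (suc (2 * u) +_) (sym n≡1+2m)))
  where
  s+s≡t+n : suc (u + m) + suc (u + m) ≡ suc (2 * u) + suc (2 * m)
  s+s≡t+n = solve (u ∷ m ∷ [])
  u<m : u < m
  u<m = *-cancelˡ-< 2 u m 2u<2m
    where
    2u<2m : 2 * u < 2 * m
    2u<2m = s≤s⁻¹ (subst (suc (2 * u) <_) n≡1+2m t<n)
  s<n : suc (u + m) < n
  s<n = subst (suc (u + m) <_) (sym n≡1+2m)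
              (s≤s (≤-trans (+-monoˡ-< m u<m) (≤-reflexive (cong (m +_) (sym (+-identityʳ m))))))

midpoint : ∀ {n m i j} → n ≡ suc (2 * m) → i < n → j < n → ∃ λ k → k < n × dist n i k ≡ dist n j k
midpoint {n} {m} {i} {j} n≡1+2m i<n j<n
  with halve {m = m} n≡1+2m (proj₁ (proj₂ (shift-offset i<n j<n)))
... | s , s+s≡t@(s<n , _ , t<n , _) with shift-target i<n s<n
... | k , i+s≡k@(_ , _ , k<n , _) = k , k<n , (begin
  dist n i k   ≡⟨ dist-shift i+s≡k ⟩
  cyc n s      ≡⟨ cong (cyc n) (shift-unique s+s≡t s+s′≡t) ⟩
  cyc n s′     ≡⟨ dist-shift (shift-offset k<n j<n) ⟨
  dist n k j   ≡⟨ dist-sym k<n j<n ⟩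
  dist n j k   ∎)
  where
  open ≡-Reasoning
  s′ = offset n k j
  s+s′≡t : Shift n s s′ (offset n i j)
  s+s′≡t = s<n , proj₁ (proj₂ (shift-offset k<n j<n)) , t<n
         , shift-trans i+s≡k (shift-offset k<n j<n) (shift-offset i<n j<n)

half-dist-descent : ∀ {N p⁻⁻ p⁻ p p⁺ p⁺⁺ q k} →
                    Shift N p⁻⁻ 1 p⁻ → Shift N p⁻ 1 p → Shift N p 1 p⁺ → Shift N p⁺ 1 p⁺⁺ → q < N →
                    ⌈ dist N p q /2⌉ ≡ suc k →
                    (⌈ dist N p⁺ q /2⌉ ≡ k ⊎ ⌈ dist N p⁻ q /2⌉ ≡ k) ⊎
                    (⌈ dist N p⁺⁺ q /2⌉ ≡ k ⊎ ⌈ dist N p⁻⁻ q /2⌉ ≡ k)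
half-dist-descent {N} {p = p} {q = q} sh₁ sh₂ sh₃ sh₄ q<N e with dist N p q in eq
... | 1           = inj₁ (Sum.map halve-to-k halve-to-k (dist-descent sh₂ sh₃ q<N eq))
  where halve-to-k = λ {r} (e′ : r ≡ 0) → trans (cong ⌈_/2⌉ e′) (suc-injective e)
... | suc (suc t) = inj₂ (Sum.map halve-to-k halve-to-k (dist-descent₂ sh₁ sh₂ sh₃ sh₄ q<N eq))
  where halve-to-k = λ {r} (e′ : r ≡ t) → trans (cong ⌈_/2⌉ e′) (suc-injective e)

-- The graph Sₙ

next : ∀ {n} (i : Fin n) → ∃ (Next i)
next {n} i with sucmod-target (toℕ<n i)
... | r′ , r′<n , sm = fromℕ< r′<n , subst (SucMod n (toℕ i)) (sym (toℕ-fromℕ< r′<n)) sm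

prev : ∀ {n} (j : Fin n) → ∃ λ i → Next i j
prev {n} j with sucmod-source (toℕ<n j)
... | r , r<n , sm = fromℕ< r<n , subst (λ r → SucMod n r (toℕ j)) (sym (toℕ-fromℕ< r<n)) sm

prev-next : ∀ {n} (i : Fin n) → proj₁ (prev (proj₁ (next i))) ≡ i
prev-next i = toℕ-injective (sucmod-injective (proj₂ (prev (proj₁ (next i)))) (proj₂ (next i)))

height : Layer → ℕ
height a = 0
height b = 0
height c = 1
height d = 2

gap : Layer → Layer → ℕ
gap L L′ = ∣ height L - height L′ ∣

position : ∀ {n} → SVertex n → ℕ
position (a , i) = 2 * toℕ i
position (b , i) = suc (2 * toℕ i)
position (c , i) = suc (2 * toℕ i)
position (d , i) = suc (2 * toℕ i)

position< : ∀ {n} (u : SVertex n) → position u < 2 * n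
position< (a , i) = *-monoʳ-< 2 (toℕ<n i)
position< (b , i) = 1+2*<2* (toℕ<n i)
position< (c , i) = 1+2*<2* (toℕ<n i)
position< (d , i) = 1+2*<2* (toℕ<n i)

private
  2*toℕ-injective : ∀ {n} {i j : Fin n} → 2 * toℕ i ≡ 2 * toℕ j → i ≡ j
  2*toℕ-injective {i = i} {j} e = toℕ-injective (*-cancelˡ-≡ (toℕ i) (toℕ j) 2 e)

position-injective : ∀ {n} {u x : SVertex n} → height (proj₁ u) ≡ height (proj₁ x) → position u ≡ position x →
                     u ≡ x
position-injective {u = a , i} {a , j} _ e = cong (a ,_) (2*toℕ-injective e)
position-injective {u = a , i} {b , j} _ e = ⊥-elim (even≢odd (toℕ i) (toℕ j) e)
position-injective {u = b , i} {a , j} _ e = ⊥-elim (even≢odd (toℕ j) (toℕ i) (sym e))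
position-injective {u = b , i} {b , j} _ e = cong (b ,_) (2*toℕ-injective (suc-injective e))
position-injective {u = c , i} {c , j} _ e = cong (c ,_) (2*toℕ-injective (suc-injective e))
position-injective {u = d , i} {d , j} _ e = cong (d ,_) (2*toℕ-injective (suc-injective e))

distance : ∀ n → SVertex n → SVertex n → ℕ
distance n u x = gap (proj₁ u) (proj₁ x) + ⌈ dist (2 * n) (position u) (position x) /2⌉

⌈n/2⌉≡0⇒n≡0 : ∀ {x} → ⌈ x /2⌉ ≡ 0 → x ≡ 0
⌈n/2⌉≡0⇒n≡0 {zero} _ = refl

∣-∣-step : ∀ h t → ∣ h - t ∣ ≤ suc ∣ suc h - t ∣ × ∣ suc h - t ∣ ≤ suc ∣ h - t ∣
∣-∣-step zero    zero    = z≤n , ≤-refl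
∣-∣-step zero    (suc t) = ≤-refl , m≤n⇒m≤1+n (n≤1+n t)
∣-∣-step (suc h) zero    = m≤n⇒m≤1+n (n≤1+n (suc h)) , ≤-refl
∣-∣-step (suc h) (suc t) = ∣-∣-step h t

module DistanceFormula {n : ℕ} (1<n : 1 < n) where

  Next⇒shift : ∀ {i j : Fin n} → Next i j → Shift n (toℕ i) 1 (toℕ j)
  Next⇒shift = sucmod⇒shift 1<n (toℕ<n _) (toℕ<n _)

  step-ab : ∀ (i : Fin n) → Shift (2 * n) (position (a , i)) 1 (position (b , i))
  step-ab i = shift-even-odd (toℕ<n i)

  step-ba : ∀ {i j : Fin n} → Next i j → Shift (2 * n) (position (b , i)) 1 (position (a , j))
  step-ba i→j = shift-odd-even (Next⇒shift i→j)

  Lipschitz : SVertex n → SVertex n → Set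
  Lipschitz u w = ∀ x → distance n u x ≤ suc (distance n w x) × distance n w x ≤ suc (distance n u x)

  private
    Near : ℕ → ℕ → Set
    Near p p′ = ∀ {q} → q < 2 * n →
                dist (2 * n) p q ≤ 2 + dist (2 * n) p′ q × dist (2 * n) p′ q ≤ 2 + dist (2 * n) p q

    near₁ : ∀ {p p′} → Shift (2 * n) p 1 p′ → Near p p′
    near₁ sh q<N with dist-step sh q<N
    ... | p≤p′ , p′≤p = m≤n⇒m≤1+n p≤p′ , m≤n⇒m≤1+n p′≤p

    add-gap : ∀ g {h h′} → h ≤ suc h′ → g + h ≤ suc (g + h′)
    add-gap g {h} {h′} h≤1+h′ = subst (g + h ≤_) (+-suc g h′) (+-monoʳ-≤ g h≤1+h′)

  horizontal-lipschitz : ∀ {u w} → (∀ L → gap (proj₁ u) L ≡ gap (proj₁ w) L) → Near (position u) (position w) →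
                         Lipschitz u w
  horizontal-lipschitz {u} {w} same-gap near x@(L , _) with near (position< x)
  ... | u≤w , w≤u = subst (λ g → distance n u x ≤ suc (g + _)) (same-gap L) (add-gap _ (⌈n/2⌉-mono u≤w))
                  , subst (λ g → distance n w x ≤ suc (g + _)) (sym (same-gap L)) (add-gap _ (⌈n/2⌉-mono w≤u))

  vertical-lipschitz : ∀ {L L′ i} → (∀ K → gap L K ≤ suc (gap L′ K) × gap L′ K ≤ suc (gap L K)) →
                       position (L , i) ≡ position (L′ , i) → Lipschitz (L , i) (L′ , i)
  vertical-lipschitz {L} {L′} {i} gaps p≡p′ x@(K , _) =
      subst (λ p → distance n (L , i) x ≤ suc (gap L′ K + half p)) p≡p′ (+-monoˡ-≤ _ (proj₁ (gaps K)))
    , subst (λ p → gap L′ K + half p ≤ suc (distance n (L , i) x)) p≡p′ (+-monoˡ-≤ _ (proj₂ (gaps K)))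
    where
    half : ℕ → ℕ
    half p = ⌈ dist (2 * n) p (position x) /2⌉

  arc-lipschitz : ∀ {u w} → SArc n u w → Lipschitz u w
  arc-lipschitz {a , i} {a , j} (aa i→j) =
    horizontal-lipschitz {a , i} {a , j} (λ _ → refl) (dist-step₂ (step-ab i) (step-ba i→j))
  arc-lipschitz {b , i} {b , j} (bb i→j) =
    horizontal-lipschitz {b , i} {b , j} (λ _ → refl) (dist-step₂ (step-ba i→j) (step-ab j))
  arc-lipschitz {c , i} {c , j} (cc i→j) =
    horizontal-lipschitz {c , i} {c , j} (λ _ → refl) (dist-step₂ (step-ba i→j) (step-ab j))
  arc-lipschitz {d , i} {d , j} (dd i→j) =
    horizontal-lipschitz {d , i} {d , j} (λ _ → refl) (dist-step₂ (step-ba i→j) (step-ab j))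
  arc-lipschitz {a , i} {b , i} ab =
    horizontal-lipschitz {a , i} {b , i} (λ _ → refl) (near₁ (step-ab i))
  arc-lipschitz {a , j} {b , i} (ab' i→j) =
    horizontal-lipschitz {a , j} {b , i} (λ _ → refl) (swap ∘ near₁ (step-ba i→j))
  arc-lipschitz {b , i} {c , i} bc = vertical-lipschitz {b} {c} {i} (λ K → ∣-∣-step 0 (height K)) refl
  arc-lipschitz {c , i} {d , i} cd = vertical-lipschitz {c} {d} {i} (λ K → ∣-∣-step 1 (height K)) refl

  distance-lipschitz : ∀ {u w} → SAdj n u w → ∀ x → distance n u x ≤ suc (distance n w x)
  distance-lipschitz (inj₁ uw) x = proj₁ (arc-lipschitz uw x)
  distance-lipschitz (inj₂ wu) x = proj₂ (arc-lipschitz wu x)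

  distance-self : ∀ (u : SVertex n) → distance n u u ≡ 0
  distance-self u = cong₂ _+_ (∣n-n∣≡0 (height (proj₁ u))) (cong ⌈_/2⌉ (dist-self (position< u)))

  ⌈dist/2⌉≡0⇒same-position : ∀ (u x : SVertex n) → ⌈ dist (2 * n) (position u) (position x) /2⌉ ≡ 0 →
                             position u ≡ position x
  ⌈dist/2⌉≡0⇒same-position u x e = dist≡0⇒≡ (position< u) (position< x) (⌈n/2⌉≡0⇒n≡0 e)

  distance≡0⇒≡ : ∀ {u x} → distance n u x ≡ 0 → u ≡ x
  distance≡0⇒≡ {u} {x} e =
    position-injective (∣m-n∣≡0⇒m≡n (m+n≡0⇒m≡0 _ e)) (⌈dist/2⌉≡0⇒same-position u x (m+n≡0⇒n≡0 _ e))

  Descent : SVertex n → SVertex n → ℕ → Set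
  Descent u x k = ∃ λ w → SAdj n u w × distance n w x ≡ k

  private
    one-less : ∀ g {h k k′} → g + suc k′ ≡ suc k → h ≡ k′ → g + h ≡ k
    one-less g {h} g+1+k′≡1+k h≡k′ =
      suc-injective (trans (sym (+-suc g h)) (trans (cong (λ h → g + suc h) h≡k′) g+1+k′≡1+k))

  descent-a : ∀ i x {k} → distance n (a , i) x ≡ suc k → Descent (a , i) x k
  descent-a i x {k} e with prev i | next i | ⌈ dist (2 * n) (position (a , i)) (position x) /2⌉ in eH
  ... | _ | _ | zero =
    ⊥-elim (0≢1+n (trans (cong (_+ 0) (sym (even-position⇒level x (⌈dist/2⌉≡0⇒same-position (a , i) x eH)))) e))
    where
    even-position⇒level : ∀ x → 2 * toℕ i ≡ position x → height (proj₁ x) ≡ 0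
    even-position⇒level (a , j) _ = refl
    even-position⇒level (b , j) e = ⊥-elim (even≢odd (toℕ i) (toℕ j) e)
    even-position⇒level (c , j) e = ⊥-elim (even≢odd (toℕ i) (toℕ j) e)
    even-position⇒level (d , j) e = ⊥-elim (even≢odd (toℕ i) (toℕ j) e)
  ... | i⁻ , i⁻→i | i⁺ , i→i⁺ | suc k′
    with half-dist-descent (step-ab i⁻) (step-ba i⁻→i) (step-ab i) (step-ba i→i⁺) (position< x) eH
  ...   | inj₁ (inj₁ e⁺)  = (b , i)  , inj₁ ab          , one-less (gap a (proj₁ x)) e e⁺
  ...   | inj₁ (inj₂ e⁻)  = (b , i⁻) , inj₁ (ab' i⁻→i)  , one-less (gap a (proj₁ x)) e e⁻
  ...   | inj₂ (inj₁ e⁺⁺) = (a , i⁺) , inj₁ (aa i→i⁺)   , one-less (gap a (proj₁ x)) e e⁺⁺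
  ...   | inj₂ (inj₂ e⁻⁻) = (a , i⁻) , inj₂ (aa i⁻→i)   , one-less (gap a (proj₁ x)) e e⁻⁻

  descent-b : ∀ i x {k} → height (proj₁ x) ≡ 0 → distance n (b , i) x ≡ suc k → Descent (b , i) x k
  descent-b i x {k} level e with prev i | next i | ⌈ dist (2 * n) (position (b , i)) (position x) /2⌉ in eH
  ... | _ | _ | zero = ⊥-elim (0≢1+n (trans (cong (_+ 0) (sym level)) e))
  ... | i⁻ , i⁻→i | i⁺ , i→i⁺ | suc k′
    with half-dist-descent (step-ba i⁻→i) (step-ab i) (step-ba i→i⁺) (step-ab i⁺) (position< x) eH
  ...   | inj₁ (inj₁ e⁺)  = (a , i⁺) , inj₂ (ab' i→i⁺)  , one-less (gap b (proj₁ x)) e e⁺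
  ...   | inj₁ (inj₂ e⁻)  = (a , i)  , inj₂ ab          , one-less (gap b (proj₁ x)) e e⁻
  ...   | inj₂ (inj₁ e⁺⁺) = (b , i⁺) , inj₁ (bb i→i⁺)   , one-less (gap b (proj₁ x)) e e⁺⁺
  ...   | inj₂ (inj₂ e⁻⁻) = (b , i⁻) , inj₂ (bb i⁻→i)   , one-less (gap b (proj₁ x)) e e⁻⁻

  distance-c-c : ∀ i j → distance n (c , i) (c , j) ≡ dist n (toℕ i) (toℕ j)
  distance-c-c i j = trans (cong ⌈_/2⌉ (dist-double (toℕ<n i) (toℕ<n j))) (⌈2*n/2⌉≡n _)

  descent-upper-layer : ∀ {L} → (∀ {i j} → Next i j → SArc n (L , i) (L , j)) →
                        (∀ i j → distance n (L , i) (L , j) ≡ dist n (toℕ i) (toℕ j)) →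
                        ∀ i j {k} → distance n (L , i) (L , j) ≡ suc k → Descent (L , i) (L , j) k
  descent-upper-layer {L} arc formula i j e with prev i | next i
  ... | i⁻ , i⁻→i | i⁺ , i→i⁺
    with dist-descent (Next⇒shift i⁻→i) (Next⇒shift i→i⁺) (toℕ<n j) (trans (sym (formula i j)) e)
  ...   | inj₁ e⁺ = (L , i⁺) , inj₁ (arc i→i⁺) , trans (formula i⁺ j) e⁺
  ...   | inj₂ e⁻ = (L , i⁻) , inj₂ (arc i⁻→i) , trans (formula i⁻ j) e⁻

  -- A vertex above or below the target's layer steps vertically, which leaves the position term
  -- unchanged; the d-d case reuses distance-c-c since both sides compute to the same term.
  descent : ∀ u x {k} → distance n u x ≡ suc k → Descent u x k
  descent (a , i) x       e = descent-a i x e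
  descent (b , i) (a , j) e = descent-b i (a , j) refl e
  descent (b , i) (b , j) e = descent-b i (b , j) refl e
  descent (b , i) (c , j) e = (c , i) , inj₁ bc , suc-injective e
  descent (b , i) (d , j) e = (c , i) , inj₁ bc , suc-injective e
  descent (c , i) (a , j) e = (b , i) , inj₂ bc , suc-injective e
  descent (c , i) (b , j) e = (b , i) , inj₂ bc , suc-injective e
  descent (c , i) (c , j) e = descent-upper-layer cc distance-c-c i j e
  descent (c , i) (d , j) e = (d , i) , inj₁ cd , suc-injective e
  descent (d , i) (a , j) e = (c , i) , inj₂ cd , suc-injective e
  descent (d , i) (b , j) e = (c , i) , inj₂ cd , suc-injective e
  descent (d , i) (c , j) e = (c , i) , inj₂ cd , suc-injective e
  descent (d , i) (d , j) e = descent-upper-layer dd distance-c-c i j e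

  distance-potential : ∀ x → DistancePotential (SAdj n) x (λ u → distance n u x)
  distance-potential x = record
    { lipschitz       = λ uw → distance-lipschitz uw x
    ; vanishes        = distance-self x
    ; vanishes⇒target = distance≡0⇒≡
    ; descent         = descent _ x
    }

-- Odd n ≥ 5

layer-code : Layer → ℕ
layer-code a = 0
layer-code b = 1
layer-code c = 2
layer-code d = 3

layer-code-injective : ∀ {L L′} → layer-code L ≡ layer-code L′ → L ≡ L′
layer-code-injective {a} {a} _ = refl
layer-code-injective {b} {b} _ = refl
layer-code-injective {c} {c} _ = refl
layer-code-injective {d} {d} _ = refl

_≟ₗ_ : DecidableEquality Layer
L ≟ₗ L′ = map′ layer-code-injective (cong layer-code) (layer-code L ≟ layer-code L′)

_≟ᵥ_ : ∀ {n} → DecidableEquality (SVertex n)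
_≟ᵥ_ = ≡-dec _≟ₗ_ _≟ᶠ_

odd⇒≡1+2* : ∀ {n} → n % 2 ≡ 1 → n ≡ suc (2 * (n / 2))
odd⇒≡1+2* {n} n%2≡1 = trans (m≡m%n+[m/n]*n n 2) (cong₂ _+_ n%2≡1 (*-comm (n / 2) 2))

next₂ prev₂ : ∀ {n} → Fin n → Fin n
next₂ i = proj₁ (next (proj₁ (next i)))
prev₂ i = proj₁ (prev (proj₁ (prev i)))

prev₂-next₂ : ∀ {n} (i : Fin n) → prev₂ (next₂ i) ≡ i
prev₂-next₂ i = trans (cong (λ j → proj₁ (prev j)) (prev-next (proj₁ (next i)))) (prev-next i)

module OddSₙ {n m : ℕ} (n≡1+2m : n ≡ suc (2 * m)) (5≤n : 5 ≤ n) where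

  10≤2n : 10 ≤ 2 * n
  10≤2n = *-monoʳ-≤ 2 5≤n

  open DistanceFormula (≤-trans (s≤s (s≤s z≤n)) 5≤n)

  layer : Layer → Fin n → SVertex n
  layer L i = L , i

  S₀ : List (SVertex n)
  S₀ = tabulate (layer a) ++ tabulate (layer c)

  a∈S₀ : ∀ i → (a , i) ∈ S₀
  a∈S₀ i = ∈-++⁺ˡ (∈-tabulate⁺ i)

  c∈S₀ : ∀ i → (c , i) ∈ S₀
  c∈S₀ i = ∈-++⁺ʳ (tabulate (layer a)) (∈-tabulate⁺ i)

  S₀-unique : Unique S₀
  S₀-unique = Unique.++⁺ (Unique.tabulate⁺ (cong proj₂)) (Unique.tabulate⁺ (cong proj₂)) disjoint
    where
    disjoint : ∀ {v} → ¬ (v ∈ tabulate (layer a) × v ∈ tabulate (layer c))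
    disjoint (v∈as , v∈cs) with ∈-tabulate⁻ {f = layer a} v∈as | ∈-tabulate⁻ {f = layer c} v∈cs
    ... | _ , refl | _ , ()

  length-S₀ : length S₀ ≡ 2 * n
  length-S₀ = trans (length-++ (tabulate (layer a)))
                    (cong₂ _+_ (length-tabulate (layer a))
                               (trans (length-tabulate (layer c)) (sym (+-identityʳ n))))

  midpoint-column : (i j : Fin n) → ∃ λ k → dist n (toℕ i) (toℕ k) ≡ dist n (toℕ j) (toℕ k)
  midpoint-column i j with midpoint {m = m} n≡1+2m (toℕ<n i) (toℕ<n j)
  ... | k , k<n , eq =
    fromℕ< k<n , subst (λ k → dist n (toℕ i) k ≡ dist n (toℕ j) k) (sym (toℕ-fromℕ< k<n)) eq

  distance-to-c : ∀ i k → distance n (b , i) (c , k) ≡ suc (dist n (toℕ i) (toℕ k))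
  distance-to-c i k = cong suc (distance-c-c i k)

  equalized-by-c : ∀ {L L′} (i j : Fin n) →
                   (∀ k → distance n (L , i) (c , k) ≡ suc (dist n (toℕ i) (toℕ k))) →
                   (∀ k → distance n (L′ , j) (c , k) ≡ suc (dist n (toℕ j) (toℕ k))) →
                   ∃ λ x → x ∈ S₀ × Equidistant (SAdj n) (L , i) (L′ , j) x
  equalized-by-c {L} {L′} i j to-c to-c′ with midpoint-column i j
  ... | k , eq = (c , k) , c∈S₀ k , equal-potential⇒Equidistant (distance-potential (c , k)) same-distance
    where
    same-distance : distance n (L , i) (c , k) ≡ distance n (L′ , j) (c , k)
    same-distance = trans (to-c k) (trans (cong suc eq) (sym (to-c′ k)))

  S₀-equalizer : IsDistanceEqualizer (SAdj n) S₀
  S₀-equalizer (a , i) _       _ u∉S₀ _    = ⊥-elim (u∉S₀ (a∈S₀ i))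
  S₀-equalizer (c , i) _       _ u∉S₀ _    = ⊥-elim (u∉S₀ (c∈S₀ i))
  S₀-equalizer _       (a , j) _ _    v∉S₀ = ⊥-elim (v∉S₀ (a∈S₀ j))
  S₀-equalizer _       (c , j) _ _    v∉S₀ = ⊥-elim (v∉S₀ (c∈S₀ j))
  S₀-equalizer (b , i) (b , j) _ _    _    = equalized-by-c i j (distance-to-c i) (distance-to-c j)
  S₀-equalizer (b , i) (d , j) _ _    _    = equalized-by-c i j (distance-to-c i) (distance-to-c j)
  S₀-equalizer (d , i) (b , j) _ _    _    = equalized-by-c i j (distance-to-c i) (distance-to-c j)
  S₀-equalizer (d , i) (d , j) _ _    _    = equalized-by-c i j (distance-to-c i) (distance-to-c j)

  c-d-separated : ∀ i x → ¬ Equidistant (SAdj n) (c , i) (d , i) x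
  c-d-separated i x@(K , _) equidistant =
    gaps-differ K
      (+-cancelʳ-≡ _ (gap c K) (gap d K) (Equidistant⇒equal-potential (distance-potential x) equidistant))
    where
    gaps-differ : ∀ K → gap c K ≢ gap d K
    gaps-differ a ()
    gaps-differ b ()
    gaps-differ c ()
    gaps-differ d ()

  shift-5 : ∀ {i j k} → Next i j → Next j k → Shift (2 * n) (position (a , i)) 5 (position (b , k))
  shift-5 {i} {j} {k} i→j j→k =
    shift-compose (shift-compose (shift-compose (shift-compose (step-ab i) (step-ba i→j) (<2n (m≤m+n 2 3)))
                                                (step-ab j) (<2n (m≤m+n 3 2)))
                                 (step-ba j→k) (<2n (m≤m+n 4 1)))
                  (step-ab k) (<2n ≤-refl)
    where
    <2n : ∀ {s} → s ≤ 5 → s < 2 * n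
    <2n s≤5 = ≤-trans (s≤s s≤5) (≤-trans (m≤m+n 6 4) 10≤2n)

  a-b-separated : ∀ {i j k} → Next i j → Next j k → ∀ x → ¬ Equidistant (SAdj n) (a , i) (b , k) x
  a-b-separated i→j j→k x@(K , _) equidistant =
    dist-5-apart {k = m} 2n≡2+4m 10≤2n (shift-5 i→j j→k) (position< x)
                 (+-cancelˡ-≡ (height K) _ _ (Equidistant⇒equal-potential (distance-potential x) equidistant))
    where
    2n≡2+4m : 2 * n ≡ 2 + 4 * m
    2n≡2+4m = trans (cong (2 *_) n≡1+2m) (solve (m ∷ []))

  module _ {S : List (SVertex n)} (S-equalizer : IsDistanceEqualizer (SAdj n) S) where

    private
      pick : ∀ {u v : SVertex n} → u ∈ S ⊎ v ∈ S → SVertex n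
      pick {u} (inj₁ _) = u
      pick {v = v} (inj₂ _) = v

      pick∈S : ∀ {u v} (h : u ∈ S ⊎ v ∈ S) → pick h ∈ S
      pick∈S (inj₁ u∈S) = u∈S
      pick∈S (inj₂ v∈S) = v∈S

      family : SVertex n → Fin n ⊎ Fin n
      family (a , i) = inj₂ i
      family (b , k) = inj₂ (prev₂ k)
      family (c , i) = inj₁ i
      family (d , i) = inj₁ i

      family-pick : ∀ {u v t} (h : u ∈ S ⊎ v ∈ S) → family u ≡ t → family v ≡ t → family (pick h) ≡ t
      family-pick (inj₁ _) fu≡t _ = fu≡t
      family-pick (inj₂ _) _ fv≡t = fv≡t

      meets : ∀ {u v} → u ≢ v → (∀ x → ¬ Equidistant (SAdj n) u v x) → u ∈ S ⊎ v ∈ S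
      meets = equalizer-meets _≟ᵥ_ S-equalizer

      c-or-d : ∀ i → (c , i) ∈ S ⊎ (d , i) ∈ S
      c-or-d i = meets (λ ()) (c-d-separated i)

      a-or-b : ∀ i → (a , i) ∈ S ⊎ (b , next₂ i) ∈ S
      a-or-b i = meets (λ ()) (a-b-separated (proj₂ (next i)) (proj₂ (next (proj₁ (next i)))))

      witness : Fin n ⊎ Fin n → SVertex n
      witness (inj₁ i) = pick (c-or-d i)
      witness (inj₂ i) = pick (a-or-b i)

      witness∈S : ∀ t → witness t ∈ S
      witness∈S (inj₁ i) = pick∈S (c-or-d i)
      witness∈S (inj₂ i) = pick∈S (a-or-b i)

      family-witness : ∀ t → family (witness t) ≡ t
      family-witness (inj₁ i) = family-pick (c-or-d i) refl refl
      family-witness (inj₂ i) = family-pick (a-or-b i) refl (cong inj₂ (prev₂-next₂ i))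

      witness-injective : ∀ {s t} → witness (splitAt n s) ≡ witness (splitAt n t) → s ≡ t
      witness-injective {s} {t} e = begin
        s                                          ≡⟨ join-splitAt n n s ⟨
        join n n (splitAt n s)                     ≡⟨ cong (join n n) (family-witness (splitAt n s)) ⟨
        join n n (family (witness (splitAt n s)))  ≡⟨ cong (join n n ∘ family) e ⟩
        join n n (family (witness (splitAt n t)))  ≡⟨ cong (join n n) (family-witness (splitAt n t)) ⟩
        join n n (splitAt n t)                     ≡⟨ join-splitAt n n t ⟩
        t                                          ∎
        where open ≡-Reasoning

    2n≤length : 2 * n ≤ length S
    2n≤length = subst (_≤ length S) (cong (n +_) (sym (+-identityʳ n)))
                      (injection⇒≤length (witness ∘ splitAt n) witness-injective (witness∈S ∘ splitAt n))

mainTheorem3 : (n : ℕ) → n % 2 ≡ 1 → 5 ≤ n → EqDim (SAdj n) (2 * n)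
mainTheorem3 n n%2≡1 5≤n = (S₀ , S₀-unique , S₀-equalizer , length-S₀) , λ _ _ → 2n≤length
  where open OddSₙ {m = n / 2} (odd⇒≡1+2* n%2≡1) 5≤n
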